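{- For every pair of justification terms $s,t$ of Denial Logic $\mathrm{DL}$ and every $\mathrm{DL}$-formula $P$, the theory $\mathrm{DL}+\{\,s:(t:P\to\lnot P)\,\}$ (Denial Logic with the formula $s:(t:P\to\lnot P)$ added as an extra axiom, closed under modus ponens) is inconsistent.
   Context: Justification terms of $\mathrm{DL}$ are built by the grammar $t ::= c_i \mid x_j \mid [t+t] \mid [t\cdot t] \mid [t\otimes t]$ from justification constants $c_i$ and justification variables $x_j$. Formulas are built by $A ::= \bot \mid A_i \mid (A\wedge A)\mid (A\vee A)\mid (A\to A)\mid \lnot A \mid t:A$, with $A_i$ propositional variables and $t$ a justification term ($t:A$ is read "$t$ justifies $A$"). Denial Logic $\mathrm{DL}$ is the Hilbert system whose axioms are: all axioms of classical propositional logic (in this language); Application: $s:(P\to Q)\to(t:P\to [s\cdot t]:Q)$; Sum: $s:P\to[s+t]:P$ and $t:P\to[s+t]:P$; Denial: $t:P\to\lnot P$; Evidence Pairing: $(s:P\wedge t:Q)\to[s\otimes t]:(P\wedge Q)$, for all terms $s,t$ and formulas $P,Q$; the only rule is modus ponens. -}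

module Defs where

open import Data.Nat using (ℕ)

data Term : Set where
  c    : ℕ → Term
  x    : ℕ → Term
  _⊕_  : Term → Term → Term
  _·_  : Term → Term → Term
  _⊗_  : Term → Term → Term

infixr 6 _∧_
infixr 5 _∨_
infixr 4 _⇒_
infix 7 _∶_
data Fm : Set where
  ⊥'   : Fm
  var  : ℕ → Fm
  _∧_  : Fm → Fm → Fm
  _∨_  : Fm → Fm → Fm
  _⇒_  : Fm → Fm → Fm
  ¬'_  : Fm → Fm
  _∶_  : Term → Fm → Fm

data ClassAx : Fm → Set where
  ax-K    : ∀ A B → ClassAx (A ⇒ B ⇒ A)
  ax-S    : ∀ A B C → ClassAx ((A ⇒ B ⇒ C) ⇒ (A ⇒ B) ⇒ A ⇒ C)
  ax-∧I   : ∀ A B → ClassAx (A ⇒ B ⇒ A ∧ B)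
  ax-∧E₁  : ∀ A B → ClassAx (A ∧ B ⇒ A)
  ax-∧E₂  : ∀ A B → ClassAx (A ∧ B ⇒ B)
  ax-∨I₁  : ∀ A B → ClassAx (A ⇒ A ∨ B)
  ax-∨I₂  : ∀ A B → ClassAx (B ⇒ A ∨ B)
  ax-∨E   : ∀ A B C → ClassAx ((A ⇒ C) ⇒ (B ⇒ C) ⇒ A ∨ B ⇒ C)
  ax-⊥E   : ∀ A → ClassAx (⊥' ⇒ A)
  ax-¬E   : ∀ A → ClassAx (¬' A ⇒ A ⇒ ⊥')
  ax-¬I   : ∀ A → ClassAx ((A ⇒ ⊥') ⇒ ¬' A)
  ax-DNE  : ∀ A → ClassAx (¬' ¬' A ⇒ A)

data DLAx : Fm → Set where
  classical : ∀ {A} → ClassAx A → DLAx A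
  application : ∀ s t P Q → DLAx (s ∶ (P ⇒ Q) ⇒ t ∶ P ⇒ (s · t) ∶ Q)
  sum₁ : ∀ s t P → DLAx (s ∶ P ⇒ (s ⊕ t) ∶ P)
  sum₂ : ∀ s t P → DLAx (t ∶ P ⇒ (s ⊕ t) ∶ P)
  denial : ∀ t P → DLAx (t ∶ P ⇒ ¬' P)
  pairing : ∀ s t P Q → DLAx ((s ∶ P ∧ t ∶ Q) ⇒ (s ⊗ t) ∶ (P ∧ Q))

data _⊢_ (Γ : Fm → Set) : Fm → Set where
  dl  : ∀ {A} → DLAx A → Γ ⊢ A
  hyp : ∀ {A} → Γ A → Γ ⊢ A
  mp  : ∀ {A B} → Γ ⊢ (A ⇒ B) → Γ ⊢ A → Γ ⊢ B

Inconsistent : (Fm → Set) → Set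
Inconsistent Γ = Γ ⊢ ⊥'

open import Relation.Binary.PropositionalEquality using (_≡_)
⟨_⟩ : Fm → Fm → Set
⟨ F ⟩ A = A ≡ F

module Submission where

open import Defs
open import Relation.Binary.PropositionalEquality using (refl)

-- Denial turns a justification of F into ¬ F, contradicting F.
justified-theorem-inconsistent :
  ∀ {Γ : Fm → Set} (s : Term) {F : Fm} → Γ ⊢ F → Γ ⊢ (s ∶ F) → Inconsistent Γ
justified-theorem-inconsistent s {F} ⊢F ⊢s∶F =
  mp (mp (dl (classical (ax-¬E F))) (mp (dl (denial s F)) ⊢s∶F)) ⊢F

proposition1p1 : ∀ (s t : Term) (P : Fm) →
    Inconsistent ⟨ s ∶ (t ∶ P ⇒ ¬' P) ⟩
proposition1p1 s t P = justified-theorem-inconsistent s (dl (denial t P)) (hyp refl)
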